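{- Let $\mathcal{T}$ be a set of binary phylogenetic $X$-trees, $S$ a tree-child cherry picking sequence, $(x,y)\in X\times X$, and $S\circ S'$ an extension of $S$ that is dominated by $S\circ\langle (x,y)\rangle$. Suppose $(x,y)$ is the $j$th pair of $S'$ and $(x,y)$ does not occur in $S'_{1,j-1}$. Then $c_{x,y}(\mathcal{T}/(S\circ S'_{1,i}))=c_{x,y}(\mathcal{T}/(S\circ S'_{1,i-1}))$ for all $i\in\{1,\dots,j-1\}$.
   Context: A binary phylogenetic $X'$-tree is a rooted tree whose root has out-degree 2, whose internal non-root nodes have in-degree 1 and out-degree 2, and whose leaves are bijectively labelled by $X'$ (or a single node if $|X'|=1$). A pair $\{x,y\}$ is a cherry of a tree if leaves $x,y$ are siblings. A cherry picking sequence is a sequence of elements $(x_i,y_i)$ with $x_i,y_i\in X$ followed by elements $(x_i,-)$; it is tree-child if no $y_j$ equals an earlier $x_i$ ($i<j$) and there is at most one element of the form $(x,-)$. $S_{i,j}$ denotes the subsequence of the $i$th through $j$th elements (empty if $j<i$); $\circ$ denotes concatenation. Applying a sequence to a tree $T$: successively, for each pair $(a,b)$, if $\{a,b\}$ is a cherry of the current tree, delete leaf $a$ and suppress the parent of $b$, otherwise do nothing; $T/S$ is the result, $\mathcal{T}/S=\{T/S:T\in\mathcal{T}\}$. $c_{x,y}(\mathcal{T}/S)$ is the number of trees in $\mathcal{T}/S$ that have $\{x,y\}$ as a cherry. An extension $S\circ S'$ of $S$ is dominated by $S\circ\langle (x,y)\rangle$ if there is an index $j>1$ such that: $(x,y)$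 is the $j$th element of $S'$; $c_{x,y}(\mathcal{T}/S)=c_{x,y}(\mathcal{T}/(S\circ S'_{1,j-1}))$; and every pair $(x',y')$ in $S'_{1,j-1}$ satisfies $y'\ne x$ and $\{x',y'\}\ne\{x,y\}$. -}

module Defs where

open import Data.Nat using (ℕ; zero; suc; _≤_; _<_; _∸_)
open import Data.Fin using (Fin; _≟_)
open import Data.Bool using (Bool; true; false; _∧_; _∨_; if_then_else_)
open import Data.Maybe using (Maybe; just; nothing)
open import Data.Product using (_×_; _,_; proj₁; proj₂; Σ; ∃)
open import Data.Sum using (_⊎_)
open import Data.List using (List; []; _∷_; _++_; map; foldl; length; filterᵇ; take; allFin)
open import Data.List.Relation.Unary.All using (All)
open import Data.List.Relation.Binary.Permutation.Propositional using (_↭_)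
open import Relation.Nullary using (¬_; does)
open import Relation.Binary.PropositionalEquality using (_≡_; _≢_)

data Tree (n : ℕ) : Set where
  leaf : Fin n → Tree n
  node : Tree n → Tree n → Tree n

leaves : ∀ {n} → Tree n → List (Fin n)
leaves (leaf x)   = x ∷ []
leaves (node l r) = leaves l ++ leaves r

-- Binary phylogenetic X-tree with X = Fin n: leaves bijectively labelled by X.
IsXTree : ∀ {n} → Tree n → Set
IsXTree {n} t = leaves t ↭ allFin n

_==_ : ∀ {n} → Fin n → Fin n → Bool
a == b = does (a ≟ b)

isCherryNode : ∀ {n} → Fin n → Fin n → Tree n → Tree n → Bool
isCherryNode a b (leaf u) (leaf v) = ((u == a) ∧ (v == b)) ∨ ((u == b) ∧ (v == a))
isCherryNode a b _ _ = false

hasCherry : ∀ {n} → Tree n → Fin n → Fin n → Bool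
hasCherry (leaf _)   a b = false
hasCherry (node l r) a b = isCherryNode a b l r ∨ hasCherry l a b ∨ hasCherry r a b

-- Picking (a,b): if {a,b} is a cherry, delete leaf a and suppress the parent of b
-- (the cherry node is replaced by the leaf b); otherwise nothing changes.
pick : ∀ {n} → Fin n → Fin n → Tree n → Tree n
pick a b (leaf z)   = leaf z
pick a b (node l r) = if isCherryNode a b l r then leaf b else node (pick a b l) (pick a b r)

-- Elements of a cherry picking sequence: (x , just y) is the pair (x,y),
-- (x , nothing) is the element (x,-).
Elem : ℕ → Set
Elem n = Fin n × Maybe (Fin n)

Seq : ℕ → Set
Seq n = List (Elem n)

applyElem : ∀ {n} → Tree n → Elem n → Tree n
applyElem t (a , just b)  = pick a b t
applyElem t (a , nothing) = t

_/_ : ∀ {n} → Tree n → Seq n → Tree n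
t / s = foldl applyElem t s

_//_ : ∀ {n} → List (Tree n) → Seq n → List (Tree n)
ts // s = map (λ t → t / s) ts

c : ∀ {n} → Fin n → Fin n → List (Tree n) → ℕ
c x y ts = length (filterᵇ (λ t → hasCherry t x y) ts)

IsCPS : ∀ {n} → Seq n → Set
IsCPS {n} s = Σ (List (Fin n × Fin n)) λ ps → Σ (List (Fin n)) λ ds →
  s ≡ map (λ p → proj₁ p , just (proj₂ p)) ps ++ map (λ a → a , nothing) ds

NoLaterYIsX : ∀ {n} → Seq n → Set
NoLaterYIsX []      = Data.Unit.⊤ where import Data.Unit
NoLaterYIsX (e ∷ s) = All (λ e' → proj₂ e' ≢ just (proj₁ e)) s × NoLaterYIsX s

IsTreeChildCPS : ∀ {n} → Seq n → Set
IsTreeChildCPS {n} s = Σ (List (Fin n × Fin n)) λ ps → Σ (List (Fin n)) λ ds →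
  (s ≡ map (λ p → proj₁ p , just (proj₂ p)) ps ++ map (λ a → a , nothing) ds)
  × length ds ≤ 1 × NoLaterYIsX s

-- the i-th element of a list, 1-indexed
elemAt : ∀ {A : Set} → ℕ → List A → Maybe A
elemAt zero          _       = nothing
elemAt (suc i)       []      = nothing
elemAt (suc zero)    (a ∷ _) = just a
elemAt (suc (suc i)) (_ ∷ s) = elemAt (suc i) s

prefix : ∀ {A : Set} → ℕ → List A → List A
prefix j s = take j s

Harmless : ∀ {n} → Fin n → Fin n → Elem n → Set
Harmless x y (x' , nothing) = Data.Unit.⊤ where import Data.Unit
Harmless x y (x' , just y') = (y' ≢ x) × ¬ ((x' ≡ x × y' ≡ y) ⊎ (x' ≡ y × y' ≡ x))

DominatedAt : ∀ {n} → List (Tree n) → Seq n → Seq n → Fin n → Fin n → ℕ → Set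
DominatedAt 𝒯 S S' x y j =
  (1 < j)
  × (elemAt j S' ≡ just (x , just y))
  × (c x y (𝒯 // S) ≡ c x y (𝒯 // (S ++ prefix (j ∸ 1) S')))
  × All (Harmless x y) (prefix (j ∸ 1) S')

Dominated : ∀ {n} → List (Tree n) → Seq n → Seq n → Fin n → Fin n → Set
Dominated 𝒯 S S' x y = ∃ λ j → DominatedAt 𝒯 S S' x y j

-- A pick (a,b) with {a,b} ≠ {x,y} never destroys a cherry {x,y}: it only changes the tree at a
-- cherry node of {a,b}, whose two children are leaves and so contain no other cherry. Hence along
-- the harmless prefix S'_{1,j₀-1} of the domination witness the count c_{x,y} is non-decreasing.
-- It takes the same value at both ends, so it is constant there; and j ≤ j₀, because the pair at
-- position j₀ would otherwise be an earlier occurrence of (x,y).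
module Submission where

open import Defs
open import Data.Nat using (ℕ; zero; suc; _≤_; _∸_; z≤n; s≤s)
open import Data.Nat.Properties
  using ( ≤-refl; ≤-trans; ≤-antisym; n≤1+n; m∸n≤m; ∸-monoˡ-≤; ≰⇒>; m≤n⇒m⊓n≡m
        ; suc[m]≤n⇒m≤pred[n]; pred[m∸n]≡m∸[1+n])
  renaming (_≤?_ to _≤ℕ?_)
open import Data.Fin using (Fin; _≟_)
open import Data.Bool using (true; false; T; _∨_)
open import Data.Bool.Properties using (T-∨; T-≡)
open import Data.Maybe using (just; nothing)
open import Data.Product using (_,_; _×_)
open import Data.Sum using (_⊎_; inj₁; inj₂) renaming (map to ⊎-map)
open import Data.List using (List; []; _∷_; _++_; map; take; drop)
open import Data.List.Properties using (foldl-++; ++-assoc; ++-identityʳ; take-take; take++drop≡id)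
open import Data.List.Relation.Unary.All using (All; []; _∷_)
open import Data.List.Relation.Unary.All.Properties using (take⁺; drop⁺)
open import Data.List.Relation.Unary.Any using (here; there)
open import Data.List.Membership.Propositional using (_∈_; _∉_)
open import Data.Empty using (⊥-elim)
open import Function.Bundles using (Equivalence)
open import Relation.Nullary using (¬_; yes; no)
open import Relation.Binary.PropositionalEquality
  using (_≡_; refl; sym; trans; cong; subst; module ≡-Reasoning)
open ≡-Reasoning

open Equivalence using (to; from)

take-take-≤ : ∀ {A : Set} (s : List A) {m m'} → m ≤ m' → take m (take m' s) ≡ take m s
take-take-≤ s {m} {m'} m≤m' = trans (take-take m m' s) (cong (λ k → take k s) (m≤n⇒m⊓n≡m m≤m'))

SamePair : ∀ {n} → Fin n → Fin n → Fin n → Fin n → Set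
SamePair a b x y = (a ≡ x × b ≡ y) ⊎ (a ≡ y × b ≡ x)

isCherryNode-leaves : ∀ {n} {x y : Fin n} u v →
  T (isCherryNode x y (leaf u) (leaf v)) → SamePair u v x y
isCherryNode-leaves {x = x} {y} u v h with u ≟ x | v ≟ y | u ≟ y | v ≟ x
... | yes p | yes q | _     | _     = inj₁ (p , q)
... | yes _ | no _  | yes p | yes q = inj₂ (p , q)
... | no _  | _     | yes p | yes q = inj₂ (p , q)

module _ {n : ℕ} {x y : Fin n} where

  module _ {a b : Fin n} where

    isCherryNode-unique : ∀ l r → T (isCherryNode x y l r) → T (isCherryNode a b l r) →
      SamePair a b x y
    isCherryNode-unique (leaf u) (leaf v) hxy hab
      with isCherryNode-leaves u v hxy | isCherryNode-leaves u v hab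
    ... | inj₁ (refl , refl) | inj₁ (refl , refl) = inj₁ (refl , refl)
    ... | inj₁ (refl , refl) | inj₂ (refl , refl) = inj₂ (refl , refl)
    ... | inj₂ (refl , refl) | inj₁ (refl , refl) = inj₂ (refl , refl)
    ... | inj₂ (refl , refl) | inj₂ (refl , refl) = inj₁ (refl , refl)

    isCherryNode⇒no-inner-cherry : ∀ l r → T (isCherryNode a b l r) →
      ¬ T (hasCherry l x y ∨ hasCherry r x y)
    isCherryNode⇒no-inner-cherry (leaf _) (leaf _) _ ()

    isCherryNode-pick : ∀ l r → T (isCherryNode x y l r) →
      T (isCherryNode x y (pick a b l) (pick a b r))
    isCherryNode-pick (leaf _) (leaf _) h = h

    pick-keeps-cherry : ¬ SamePair a b x y → ∀ t →
      T (hasCherry t x y) → T (hasCherry (pick a b t) x y)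
    pick-keeps-cherry ne (node l r) h
      with isCherryNode a b l r in picked | to (T-∨ {isCherryNode x y l r}) h
    ... | true  | inj₁ xy    = ⊥-elim (ne (isCherryNode-unique l r xy (from T-≡ picked)))
    ... | true  | inj₂ inner = ⊥-elim (isCherryNode⇒no-inner-cherry l r (from T-≡ picked) inner)
    ... | false | inj₁ xy    =
      from (T-∨ {isCherryNode x y (pick a b l) (pick a b r)}) (inj₁ (isCherryNode-pick l r xy))
    ... | false | inj₂ inner =
      from (T-∨ {isCherryNode x y (pick a b l) (pick a b r)})
        (inj₂ (from (T-∨ {hasCherry (pick a b l) x y})
          (⊎-map (pick-keeps-cherry ne l) (pick-keeps-cherry ne r)
            (to (T-∨ {hasCherry l x y}) inner))))

  /-keeps-cherry : ∀ q t → All (Harmless x y) q →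
    T (hasCherry t x y) → T (hasCherry (t / q) x y)
  /-keeps-cherry []                  t []              h = h
  /-keeps-cherry ((_ , nothing) ∷ q) t (_ ∷ hs)        h = /-keeps-cherry q t hs h
  /-keeps-cherry ((a , just b) ∷ q)  t ((_ , ne) ∷ hs) h =
    /-keeps-cherry q (pick a b t) hs (pick-keeps-cherry ne t h)

  c-map-mono : ∀ (f g : Tree n → Tree n) ts →
    (∀ t → T (hasCherry (f t) x y) → T (hasCherry (g t) x y)) →
    c x y (map f ts) ≤ c x y (map g ts)
  c-map-mono f g []       f⇒g = z≤n
  c-map-mono f g (t ∷ ts) f⇒g
    with hasCherry (f t) x y in ef | hasCherry (g t) x y in eg
  ... | true  | true  = s≤s (c-map-mono f g ts f⇒g)
  ... | true  | false = ⊥-elim (subst T eg (f⇒g t (from T-≡ ef)))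
  ... | false | true  = ≤-trans (c-map-mono f g ts f⇒g) (n≤1+n _)
  ... | false | false = c-map-mono f g ts f⇒g

  c-harmless-extension : ∀ 𝒯 s q → All (Harmless x y) q →
    c x y (𝒯 // s) ≤ c x y (𝒯 // (s ++ q))
  c-harmless-extension 𝒯 s q hq = c-map-mono _ _ 𝒯 λ t h →
    subst (λ u → T (hasCherry u x y)) (sym (foldl-++ applyElem t s q))
      (/-keeps-cherry q (t / s) hq h)

  c-harmless-prefix-mono : ∀ 𝒯 S s' {K m m'} → All (Harmless x y) (take K s') →
    m ≤ m' → m' ≤ K → c x y (𝒯 // (S ++ take m s')) ≤ c x y (𝒯 // (S ++ take m' s'))
  c-harmless-prefix-mono 𝒯 S s' {K} {m} {m'} hK m≤m' m'≤K =
    subst (λ u → c x y (𝒯 // (S ++ take m s')) ≤ c x y (𝒯 // u)) split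
      (c-harmless-extension 𝒯 (S ++ take m s') rest harmless-rest)
    where
    rest : Seq n
    rest = drop m (take m' s')

    split : (S ++ take m s') ++ rest ≡ S ++ take m' s'
    split = begin
      (S ++ take m s') ++ rest              ≡⟨ ++-assoc S (take m s') rest ⟩
      S ++ (take m s' ++ rest)              ≡⟨ cong (λ u → S ++ (u ++ rest)) (sym (take-take-≤ s' m≤m')) ⟩
      S ++ (take m (take m' s') ++ rest)    ≡⟨ cong (S ++_) (take++drop≡id m (take m' s')) ⟩
      S ++ take m' s'                       ∎

    harmless-rest : All (Harmless x y) rest
    harmless-rest = drop⁺ m (subst (All (Harmless x y)) (take-take-≤ s' m'≤K) (take⁺ m' hK))

monotone-squeeze : ∀ (f : ℕ → ℕ) K → (∀ {m m'} → m ≤ m' → m' ≤ K → f m ≤ f m') →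
  f 0 ≡ f K → ∀ {i} → i ≤ K → f i ≡ f 0
monotone-squeeze f K mono f0≡fK {i} i≤K =
  ≤-antisym (subst (f i ≤_) (sym f0≡fK) (mono i≤K ≤-refl)) (mono z≤n i≤K)

elemAt⇒∈-take : ∀ {A : Set} {a : A} k K s → elemAt k s ≡ just a → k ≤ K → a ∈ take K s
elemAt⇒∈-take zero          _       _       ()
elemAt⇒∈-take (suc _)       _       []      ()
elemAt⇒∈-take (suc zero)    (suc K) (b ∷ s) refl _ = here refl
elemAt⇒∈-take (suc (suc k)) (suc K) (b ∷ s) e (s≤s k≤K) =
  there (elemAt⇒∈-take (suc k) K s e k≤K)

elemAt-∉-prefix⇒≤ : ∀ {A : Set} {a : A} k j s →
  elemAt k s ≡ just a → a ∉ take (j ∸ 1) s → j ≤ k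
elemAt-∉-prefix⇒≤ k j s e a∉ with j ≤ℕ? k
... | yes j≤k = j≤k
... | no j≰k  = ⊥-elim (a∉ (elemAt⇒∈-take k (j ∸ 1) s e
                  (subst (k ≤_) (pred[m∸n]≡m∸[1+n] j 0) (suc[m]≤n⇒m≤pred[n] (≰⇒> j≰k)))))

lemma19 : (n : ℕ) (𝒯 : List (Tree n)) → All IsXTree 𝒯 →
    (S : Seq n) → IsTreeChildCPS S →
    (S' : Seq n) → IsCPS (S ++ S') →
    (x y : Fin n) → Dominated 𝒯 S S' x y →
    (j : ℕ) → elemAt j S' ≡ just (x , just y) → (x , just y) ∉ prefix (j ∸ 1) S' →
    (i : ℕ) → 1 ≤ i → i ≤ j ∸ 1 →
    c x y (𝒯 // (S ++ prefix i S')) ≡ c x y (𝒯 // (S ++ prefix (i ∸ 1) S'))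
lemma19 n 𝒯 _ S _ S' _ x y (j₀ , _ , at-j₀ , same-count , harmless) j _ not-earlier i _ i≤j-1 =
  trans (constant i≤K) (sym (constant (≤-trans (m∸n≤m i 1) i≤K)))
  where
  K : ℕ
  K = j₀ ∸ 1

  count : ℕ → ℕ
  count m = c x y (𝒯 // (S ++ take m S'))

  i≤K : i ≤ K
  i≤K = ≤-trans i≤j-1 (∸-monoˡ-≤ 1 (elemAt-∉-prefix⇒≤ j₀ j S' at-j₀ not-earlier))

  constant : ∀ {m} → m ≤ K → count m ≡ count 0
  constant = monotone-squeeze count K (c-harmless-prefix-mono 𝒯 S S' harmless)
    (trans (cong (λ s → c x y (𝒯 // s)) (++-identityʳ S)) same-count)
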